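{- Let $G$ be a graph and let $G[U]$ be a maximum induced interval subgraph of $G$. For any module $M$ of $G$ with $M\cap U\neq\emptyset$, the set $M\cap U$ is a module of $G[U]$; and if $G$ is $4$-hole-free, then for every maximum induced interval subgraph $G[U_M]$ of $G[M]$ (with $U_M\subseteq M$), the graph $G[(U\setminus M)\cup U_M]$ is a maximum induced interval subgraph of $G$.
   Context: Graphs are finite, simple, undirected. A module of $G$ is a set $M\subseteq V(G)$ such that every vertex outside $M$ is adjacent either to all vertices of $M$ or to none of them. A maximum induced interval subgraph of $G$ is an induced subgraph $G[U]$ that is an interval graph with $|U|$ maximum among all such. A $4$-hole is an induced cycle on four vertices; $G$ is $4$-hole-free if it has none. The graph $G[(U\setminus M)\cup U_M]$ is what the paper calls replacing $G[M\cap U]$ by $G[U_M]$ in $G[U]$. -}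

module Defs where

open import Data.Nat using (ℕ; _≤_)
open import Data.Bool using (Bool; true; false)
open import Data.Fin using (Fin)
open import Data.Fin.Subset using (Subset; _∈_; _∉_; _⊆_; ∣_∣)
open import Data.Product using (_×_; ∃)
open import Data.Sum using (_⊎_)
open import Relation.Nullary using (¬_)
open import Relation.Binary.PropositionalEquality using (_≡_)
open import Function.Bundles using (_⇔_)

record Graph (n : ℕ) : Set where
  field
    adj   : Fin n → Fin n → Bool
    sym   : ∀ u v → adj u v ≡ adj v u
    irrfl : ∀ v → adj v v ≡ false

open Graph public

module _ {n : ℕ} (G : Graph n) where

  Adj : Fin n → Fin n → Set
  Adj u v = adj G u v ≡ true

  IsModuleIn : Subset n → Subset n → Set
  IsModuleIn W M =
    M ⊆ W ×
    (∀ x → x ∈ W → x ∉ M →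
       (∀ y → y ∈ M → Adj x y) ⊎ (∀ y → y ∈ M → ¬ Adj x y))

  -- G[U] is an interval graph: there is an assignment of closed intervals
  -- [left v, right v] (left v ≤ right v) to the vertices of U such that two
  -- distinct vertices of U are adjacent iff their intervals intersect.
  -- (Endpoints in ℕ: for finite graphs this is equivalent to real endpoints.)
  IsIntervalOn : Subset n → Set
  IsIntervalOn U =
    ∃ λ (left : Fin n → ℕ) → ∃ λ (right : Fin n → ℕ) →
      (∀ v → v ∈ U → left v ≤ right v) ×
      (∀ u v → u ∈ U → v ∈ U → ¬ u ≡ v →
         (Adj u v ⇔ (left u ≤ right v × left v ≤ right u)))

  IsMaxIntervalIn : Subset n → Subset n → Set
  IsMaxIntervalIn W U =
    U ⊆ W × IsIntervalOn U ×
    (∀ U′ → U′ ⊆ W → IsIntervalOn U′ → ∣ U′ ∣ ≤ ∣ U ∣)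

  -- G has no induced 4-cycle a-b-c-d-a on four distinct vertices
  -- (distinctness of adjacent pairs follows from irreflexivity).
  FourHoleFree : Set
  FourHoleFree =
    ∀ a b c d → ¬ a ≡ c → ¬ b ≡ d →
      ¬ (Adj a b × Adj b c × Adj c d × Adj d a × ¬ Adj a c × ¬ Adj b d)

-- For part two, the size bound is
-- |U| = |U ─ M| + |U ∩ M| ≤ |U ─ M| + |UM|, since G[U ∩ M] is an interval subgraph of G[M];
-- the work is to build an interval model of G[(U ─ M) ∪ UM] from models of G[U] and G[UM].
-- Fix v ∈ U ∩ M. A vertex of U ─ M sees UM iff it sees v, because M is a module.
-- If UM is a clique, every vertex of UM gets the interval of v. Otherwise UM has two
-- nonadjacent vertices, so by 4-hole-freeness the neighbours of M in U ─ M are pairwise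
-- adjacent; by the Helly property their intervals and that of v share a point p, which no
-- non-neighbour's interval contains. Cutting the line open at p and placing a translated
-- model of G[UM] in the gap gives the required model.
module Submission where

open import Defs hiding (sym)
open import Data.Bool using (true; if_then_else_)
import Data.Bool as Bool
open import Data.Empty using (⊥-elim)
open import Data.Fin using (Fin; zero; suc; _≟_)
open import Data.Fin.Properties using (all?)
open import Data.Fin.Subset
  using (Subset; inside; outside; _∈_; _∉_; _⊆_; ∣_∣; _∩_; _∪_; _─_; ⊤; Empty)
open import Data.Fin.Subset.Properties
  using (_∈?_; ∈⊤; ⊆⊤; x∈p∩q⁺; x∈p∩q⁻; x∈p∪q⁻; p∩q⊆p; p∩q⊆q; p─q⊆p; drop-∷-Empty)
open import Data.Nat using (ℕ; zero; suc; _+_; _⊔_; _≤_; _<_; z≤n; s≤s; _≤?_)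
open import Data.Nat.Properties
  using (≤-refl; ≤-trans; ≤-pred; n≤1+n; m≤m+n; +-suc; +-monoˡ-≤; +-monoʳ-≤;
         +-cancelˡ-≤; +-cancelʳ-≤; <⇒≱; ≰⇒>; m≤m⊔n; m≤n⇒m≤o⊔n; ⊔-lub; module ≤-Reasoning)
open import Data.Product using (_×_; ∃; ∃-syntax; _,_; proj₁; proj₂; swap)
open import Data.Product.Function.NonDependent.Propositional using (_×-⇔_)
open import Data.Sum using (_⊎_; inj₁; inj₂; [_,_])
import Data.Sum as Sum
open import Data.Vec using (_∷_; []; here; there)
open import Function using (_∘_; const)
open import Function.Bundles using (_⇔_; mk⇔; Equivalence)
open import Function.Construct.Composition using (_⇔-∘_)
open import Function.Construct.Symmetry using (⇔-sym)
open import Relation.Nullary using (¬_; Dec; yes; no; does; ¬?; contradiction)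
open import Relation.Nullary.Decidable using (_→-dec_; _×-dec_; _⊎-dec_)
open import Relation.Unary using (Pred; Decidable)
open import Relation.Binary.PropositionalEquality
  using (_≡_; _≢_; refl; sym; trans; cong; cong₂; subst; subst₂)

open Equivalence using (to; from)

private
  variable
    n : ℕ

∣p∣≡∣p─q∣+∣p∩q∣ : (p q : Subset n) → ∣ p ∣ ≡ ∣ p ─ q ∣ + ∣ p ∩ q ∣
∣p∣≡∣p─q∣+∣p∩q∣ []            []            = refl
∣p∣≡∣p─q∣+∣p∩q∣ (inside  ∷ p) (inside  ∷ q) =
  trans (cong suc (∣p∣≡∣p─q∣+∣p∩q∣ p q)) (sym (+-suc ∣ p ─ q ∣ ∣ p ∩ q ∣))
∣p∣≡∣p─q∣+∣p∩q∣ (inside  ∷ p) (outside ∷ q) = cong suc (∣p∣≡∣p─q∣+∣p∩q∣ p q)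
∣p∣≡∣p─q∣+∣p∩q∣ (outside ∷ p) (inside  ∷ q) = ∣p∣≡∣p─q∣+∣p∩q∣ p q
∣p∣≡∣p─q∣+∣p∩q∣ (outside ∷ p) (outside ∷ q) = ∣p∣≡∣p─q∣+∣p∩q∣ p q

∣p∪q∣≡∣p∣+∣q∣ : (p q : Subset n) → Empty (p ∩ q) → ∣ p ∪ q ∣ ≡ ∣ p ∣ + ∣ q ∣
∣p∪q∣≡∣p∣+∣q∣ []            []            _    = refl
∣p∪q∣≡∣p∣+∣q∣ (inside  ∷ p) (inside  ∷ q) disj = contradiction (zero , here) disj
∣p∪q∣≡∣p∣+∣q∣ (inside  ∷ p) (outside ∷ q) disj =
  cong suc (∣p∪q∣≡∣p∣+∣q∣ p q (drop-∷-Empty disj))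
∣p∪q∣≡∣p∣+∣q∣ (outside ∷ p) (inside  ∷ q) disj =
  trans (cong suc (∣p∪q∣≡∣p∣+∣q∣ p q (drop-∷-Empty disj))) (sym (+-suc ∣ p ∣ ∣ q ∣))
∣p∪q∣≡∣p∣+∣q∣ (outside ∷ p) (outside ∷ q) disj = ∣p∪q∣≡∣p∣+∣q∣ p q (drop-∷-Empty disj)

x∈p─q⇒x∉q : ∀ {x : Fin n} (p q : Subset n) → x ∈ p ─ q → x ∉ q
x∈p─q⇒x∉q (_ ∷ p) (outside ∷ q) here          ()
x∈p─q⇒x∉q (_ ∷ p) (inside  ∷ q) (there x∈p─q) (there x∈q) = x∈p─q⇒x∉q p q x∈p─q x∈q
x∈p─q⇒x∉q (_ ∷ p) (outside ∷ q) (there x∈p─q) (there x∈q) = x∈p─q⇒x∉q p q x∈p─q x∈q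

-- Suprema and the Helly property of intervals

record Supremum {ℓ} (f : Fin n → ℕ) (P : Pred (Fin n) ℓ) : Set ℓ where
  field
    value : ℕ
    upper : ∀ x → P x → f x ≤ value
    least : ∀ b → (∀ x → P x → f x ≤ b) → value ≤ b

supremum : ∀ {ℓ} (f : Fin n → ℕ) {P : Pred (Fin n) ℓ} → Decidable P → Supremum f P
supremum {zero}  f P? = record { value = 0 ; upper = λ () ; least = λ _ _ → z≤n }
supremum {suc n} f P? with supremum (f ∘ suc) (P? ∘ suc) | P? zero
... | s | yes P0 = let open Supremum s in record
  { value = f zero ⊔ value
  ; upper = λ { zero _ → m≤m⊔n (f zero) value
              ; (suc x) Px → m≤n⇒m≤o⊔n (f zero) (upper x Px) }
  ; least = λ b bound → ⊔-lub (bound zero P0) (least b (bound ∘ suc))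
  }
... | s | no ¬P0 = let open Supremum s in record
  { value = value
  ; upper = λ { zero P0 → contradiction P0 ¬P0 ; (suc x) → upper x }
  ; least = λ b bound → least b (bound ∘ suc)
  }

-- The largest left endpoint lies in every interval of a pairwise intersecting family.
helly : ∀ {ℓ} (l r : Fin n → ℕ) {P : Pred (Fin n) ℓ} → Decidable P →
        (∀ x y → P x → P y → l x ≤ r y) →
        ∃[ p ] (∀ x → P x → l x ≤ p × p ≤ r x)
helly l r P? meet = value , λ x Px → upper x Px , least (r x) (λ y Py → meet y x Py Px)
  where open Supremum (supremum l P?)

-- Opening a gap in the line

shiftFrom : ℕ → ℕ → ℕ → ℕ
shiftFrom c d a with c ≤? a
... | yes _ = a + d
... | no  _ = a

shiftFrom-≥ : ∀ {c d a} → c ≤ a → shiftFrom c d a ≡ a + d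
shiftFrom-≥ {c} {d} {a} c≤a with c ≤? a
... | yes _   = refl
... | no  c≰a = contradiction c≤a c≰a

shiftFrom-< : ∀ {c d a} → a < c → shiftFrom c d a ≡ a
shiftFrom-< {c} {d} {a} a<c with c ≤? a
... | yes c≤a = contradiction c≤a (<⇒≱ a<c)
... | no  _   = refl

≤-shiftFrom : ∀ c d a → a ≤ shiftFrom c d a
≤-shiftFrom c d a with c ≤? a
... | yes _ = m≤m+n a d
... | no  _ = ≤-refl

-- Shifting left endpoints from p + 1 on but right endpoints from p on stretches every
-- interval containing p over the whole gap [p, p + d].
≤⇔shiftFrom-≤ : ∀ p d a b → a ≤ b ⇔ shiftFrom (suc p) d a ≤ shiftFrom p d b
≤⇔shiftFrom-≤ p d a b = mk⇔ (shifted (suc p ≤? a)) left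
  where
  open ≤-Reasoning

  shifted : Dec (suc p ≤ a) → a ≤ b → shiftFrom (suc p) d a ≤ shiftFrom p d b
  shifted (yes p<a) a≤b = begin
    shiftFrom (suc p) d a ≡⟨ shiftFrom-≥ p<a ⟩
    a + d                 ≤⟨ +-monoˡ-≤ d a≤b ⟩
    b + d                 ≡⟨ shiftFrom-≥ (≤-trans (n≤1+n p) (≤-trans p<a a≤b)) ⟨
    shiftFrom p d b       ∎
  shifted (no p≮a) a≤b = begin
    shiftFrom (suc p) d a ≡⟨ shiftFrom-< (≰⇒> p≮a) ⟩
    a                     ≤⟨ a≤b ⟩
    b                     ≤⟨ ≤-shiftFrom p d b ⟩
    shiftFrom p d b       ∎

  left : shiftFrom (suc p) d a ≤ shiftFrom p d b → a ≤ b
  left = by-cases (p ≤? b) (suc p ≤? a)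
    where
    by-cases : Dec (p ≤ b) → Dec (suc p ≤ a) → shiftFrom (suc p) d a ≤ shiftFrom p d b → a ≤ b
    by-cases (yes p≤b) (yes p<a) h =
      +-cancelʳ-≤ d a b (subst₂ _≤_ (shiftFrom-≥ p<a) (shiftFrom-≥ p≤b) h)
    by-cases (yes p≤b) (no p≮a) _ = ≤-trans (≤-pred (≰⇒> p≮a)) p≤b
    by-cases (no p≰b)  _        h =
      ≤-trans (≤-shiftFrom (suc p) d a) (subst (_ ≤_) (shiftFrom-< (≰⇒> p≰b)) h)

shiftFrom-meets-gap : ∀ {p d la ra lb rb} → lb ≤ d → rb ≤ d →
  (shiftFrom (suc p) d la ≤ p + rb × p + lb ≤ shiftFrom p d ra) ⇔ (la ≤ p × p ≤ ra)
shiftFrom-meets-gap {p} {d} {la} {ra} {lb} {rb} lb≤d rb≤d = mk⇔ contains meets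
  where
  open ≤-Reasoning

  contains : shiftFrom (suc p) d la ≤ p + rb × p + lb ≤ shiftFrom p d ra → la ≤ p × p ≤ ra
  contains (left , right) = la≤p (suc p ≤? la) , p≤ra (p ≤? ra)
    where
    la≤p : Dec (suc p ≤ la) → la ≤ p
    la≤p (no p≮la)  = ≤-pred (≰⇒> p≮la)
    la≤p (yes p<la) = contradiction (begin
      la + d                 ≡⟨ shiftFrom-≥ p<la ⟨
      shiftFrom (suc p) d la ≤⟨ left ⟩
      p + rb                 ≤⟨ +-monoʳ-≤ p rb≤d ⟩
      p + d                  ∎) (<⇒≱ (+-monoˡ-≤ d p<la))

    p≤ra : Dec (p ≤ ra) → p ≤ ra
    p≤ra (yes p≤ra) = p≤ra
    p≤ra (no p≰ra)  = contradiction (begin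
      p                ≤⟨ m≤m+n p lb ⟩
      p + lb           ≤⟨ right ⟩
      shiftFrom p d ra ≡⟨ shiftFrom-< (≰⇒> p≰ra) ⟩
      ra               ∎) p≰ra

  meets : la ≤ p × p ≤ ra → shiftFrom (suc p) d la ≤ p + rb × p + lb ≤ shiftFrom p d ra
  meets (la≤p , p≤ra) = (begin
    shiftFrom (suc p) d la ≡⟨ shiftFrom-< (s≤s la≤p) ⟩
    la                     ≤⟨ la≤p ⟩
    p                      ≤⟨ m≤m+n p rb ⟩
    p + rb                 ∎) , (begin
    p + lb                 ≤⟨ +-monoʳ-≤ p lb≤d ⟩
    p + d                  ≤⟨ +-monoˡ-≤ d p≤ra ⟩
    ra + d                 ≡⟨ shiftFrom-≥ p≤ra ⟨
    shiftFrom p d ra       ∎)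

+-≤⇔ : ∀ p a b → a ≤ b ⇔ p + a ≤ p + b
+-≤⇔ p a b = mk⇔ (+-monoʳ-≤ p) (+-cancelˡ-≤ p a b)

piecewise : Subset n → (Fin n → ℕ) → (Fin n → ℕ) → Fin n → ℕ
piecewise S f g x = if does (x ∈? S) then f x else g x

piecewise-∈ : ∀ {S : Subset n} {f g x} → x ∈ S → piecewise S f g x ≡ f x
piecewise-∈ {S = S} {x = x} x∈S with x ∈? S
... | yes _   = refl
... | no  x∉S = contradiction x∈S x∉S

piecewise-∉ : ∀ {S : Subset n} {f g x} → x ∉ S → piecewise S f g x ≡ g x
piecewise-∉ {S = S} {x = x} x∉S with x ∈? S
... | yes x∈S = contradiction x∈S x∉S
... | no  _   = refl

Meet : (l r : Fin n → ℕ) → Fin n → Fin n → Set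
Meet l r u v = l u ≤ r v × l v ≤ r u

module _ (G : Graph n) where

  adj? : ∀ u v → Dec (Adj G u v)
  adj? u v = adj G u v Bool.≟ true

  Adj-sym : ∀ {u v} → Adj G u v → Adj G v u
  Adj-sym {u} {v} = trans (Graph.sym G v u)

  Clique : Subset n → Set
  Clique S = ∀ u v → u ∈ S → v ∈ S → u ≢ v → Adj G u v

  clique? : ∀ S → Dec (Clique S)
  clique? S = all? λ u → all? λ v →
    (u ∈? S) →-dec (v ∈? S) →-dec ¬? (u ≟ v) →-dec adj? u v

  IsModuleIn-∩ : ∀ {W V M} → V ⊆ W → IsModuleIn G W M → IsModuleIn G V (M ∩ V)
  IsModuleIn-∩ {V = V} {M} V⊆W (_ , uniform) = p∩q⊆q M V , λ x x∈V x∉M∩V →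
    Sum.map (λ all y → all y ∘ in-M) (λ none y → none y ∘ in-M)
            (uniform x (V⊆W x∈V) (λ x∈M → x∉M∩V (x∈p∩q⁺ (x∈M , x∈V))))
    where
    in-M : ∀ {y} → y ∈ M ∩ V → y ∈ M
    in-M = proj₁ ∘ x∈p∩q⁻ M V

  IsModuleIn-adj⇔ : ∀ {W M x y z} → IsModuleIn G W M → x ∈ W → x ∉ M → y ∈ M → z ∈ M →
    Adj G x y ⇔ Adj G x z
  IsModuleIn-adj⇔ {x = x} {y} {z} (_ , uniform) x∈W x∉M y∈M z∈M with uniform x x∈W x∉M
  ... | inj₁ all  = mk⇔ (const (all z z∈M)) (const (all y y∈M))
  ... | inj₂ none = mk⇔ (⊥-elim ∘ none y y∈M) (⊥-elim ∘ none z z∈M)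

  common-neighbours-clique : FourHoleFree G → ∀ {a b S} → a ≢ b → ¬ Adj G a b →
    (∀ u → u ∈ S → Adj G a u × Adj G b u) → Clique S
  common-neighbours-clique hole-free {a} {b} a≢b ¬ab common u₁ u₂ u₁∈S u₂∈S u₁≢u₂
    with adj? u₁ u₂
  ... | yes u₁u₂ = u₁u₂
  ... | no ¬u₁u₂ =
    let (au₁ , bu₁) = common u₁ u₁∈S
        (au₂ , bu₂) = common u₂ u₂∈S
    in ⊥-elim (hole-free a u₁ b u₂ a≢b u₁≢u₂
                 (au₁ , Adj-sym bu₁ , bu₂ , Adj-sym au₂ , ¬ab , ¬u₁u₂))

  record Represents (U : Subset n) (l r : Fin n → ℕ) : Set where
    field
      left≤right : ∀ v → v ∈ U → l v ≤ r v
      adj⇔meet   : ∀ u v → u ∈ U → v ∈ U → u ≢ v → Adj G u v ⇔ Meet l r u v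

  open Represents

  represents⇒interval : ∀ {U l r} → Represents U l r → IsIntervalOn G U
  represents⇒interval {l = l} {r} R = l , r , left≤right R , adj⇔meet R

  Represents-⊆ : ∀ {U V l r} → V ⊆ U → Represents U l r → Represents V l r
  Represents-⊆ V⊆U R = record
    { left≤right = λ v → left≤right R v ∘ V⊆U
    ; adj⇔meet   = λ u v u∈V v∈V → adj⇔meet R u v (V⊆U u∈V) (V⊆U v∈V)
    }

  Represents-cong : ∀ {U l r l′ r′} →
    (∀ x → x ∈ U → l x ≡ l′ x) → (∀ x → x ∈ U → r x ≡ r′ x) →
    Represents U l r → Represents U l′ r′
  Represents-cong {U} {l} {r} {l′} {r′} l≡l′ r≡r′ R = record
    { left≤right = λ v v∈U → subst₂ _≤_ (l≡l′ v v∈U) (r≡r′ v v∈U) (left≤right R v v∈U)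
    ; adj⇔meet   = λ u v u∈U v∈U u≢v →
        subst (Adj G u v ⇔_) (Meet≡ u∈U v∈U) (adj⇔meet R u v u∈U v∈U u≢v)
    }
    where
    Meet≡ : ∀ {u v} → u ∈ U → v ∈ U → Meet l r u v ≡ Meet l′ r′ u v
    Meet≡ {u} {v} u∈U v∈U = cong₂ _×_ (cong₂ _≤_ (l≡l′ u u∈U) (r≡r′ v v∈U))
                                      (cong₂ _≤_ (l≡l′ v v∈U) (r≡r′ u u∈U))

  Represents-reparametrise : ∀ {U l r} (f g : ℕ → ℕ) → (∀ a b → a ≤ b ⇔ f a ≤ g b) →
    Represents U l r → Represents U (f ∘ l) (g ∘ r)
  Represents-reparametrise {l = l} {r} f g embedding R = record
    { left≤right = λ v v∈U → to (embedding (l v) (r v)) (left≤right R v v∈U)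
    ; adj⇔meet   = λ u v u∈U v∈U u≢v →
        (embedding (l u) (r v) ×-⇔ embedding (l v) (r u)) ⇔-∘ adj⇔meet R u v u∈U v∈U u≢v
    }

  Represents-∪ : ∀ {A B l r} → Represents A l r → Represents B l r →
    (∀ a b → a ∈ A → b ∈ B → a ≢ b → Adj G a b ⇔ Meet l r a b) →
    Represents (A ∪ B) l r
  Represents-∪ {A} {B} {l} {r} RA RB cross = record
    { left≤right = λ v v∈A∪B → [ left≤right RA v , left≤right RB v ] (x∈p∪q⁻ A B v∈A∪B)
    ; adj⇔meet   = adj⇔meet′
    }
    where
    swapped : ∀ {u v} → Adj G v u ⇔ Meet l r v u → Adj G u v ⇔ Meet l r u v
    swapped e = mk⇔ (swap ∘ to e ∘ Adj-sym) (Adj-sym ∘ from e ∘ swap)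

    adj⇔meet′ : ∀ u v → u ∈ A ∪ B → v ∈ A ∪ B → u ≢ v → Adj G u v ⇔ Meet l r u v
    adj⇔meet′ u v u∈ v∈ u≢v with x∈p∪q⁻ A B u∈ | x∈p∪q⁻ A B v∈
    ... | inj₁ u∈A | inj₁ v∈A = adj⇔meet RA u v u∈A v∈A u≢v
    ... | inj₂ u∈B | inj₂ v∈B = adj⇔meet RB u v u∈B v∈B u≢v
    ... | inj₁ u∈A | inj₂ v∈B = cross u v u∈A v∈B u≢v
    ... | inj₂ u∈B | inj₁ v∈A = swapped (cross v u v∈A u∈B (u≢v ∘ sym))

  Represents-clique : ∀ {S i j} → Clique S → i ≤ j → Represents S (const i) (const j)
  Represents-clique S-clique i≤j = record
    { left≤right = λ _ _ → i≤j
    ; adj⇔meet   = λ u v u∈S v∈S u≢v →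
        mk⇔ (const (i≤j , i≤j)) (const (S-clique u v u∈S v∈S u≢v))
    }

  Represents-glue : ∀ {A B l r l′ r′} → (∀ x → x ∈ A → x ∉ B) →
    Represents A l r → Represents B l′ r′ →
    (∀ a b → a ∈ A → b ∈ B → Adj G a b ⇔ (l a ≤ r′ b × l′ b ≤ r a)) →
    Represents (A ∪ B) (piecewise B l′ l) (piecewise B r′ r)
  Represents-glue {A} {B} {l} {r} {l′} {r′} disjoint RA RB cross =
    Represents-∪ (Represents-cong (on-A l′ l) (on-A r′ r) RA)
                 (Represents-cong (on-B l′ l) (on-B r′ r) RB) cross′
    where
    on-A : ∀ f g x → x ∈ A → g x ≡ piecewise B f g x
    on-A f g x x∈A = sym (piecewise-∉ {f = f} {g} (disjoint x x∈A))

    on-B : ∀ f g x → x ∈ B → f x ≡ piecewise B f g x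
    on-B f g x x∈B = sym (piecewise-∈ {f = f} {g} x∈B)

    cross′ : ∀ a b → a ∈ A → b ∈ B → a ≢ b →
      Adj G a b ⇔ Meet (piecewise B l′ l) (piecewise B r′ r) a b
    cross′ a b a∈A b∈B _ =
      subst (Adj G a b ⇔_)
        (cong₂ _×_ (cong₂ _≤_ (on-A l′ l a a∈A) (on-B r′ r b b∈B))
                   (cong₂ _≤_ (on-B l′ l b b∈B) (on-A r′ r a a∈A)))
        (cross a b a∈A b∈B)

  -- The model of A is cut open at p and the model of B, translated by p, fills the gap.
  insert-at-point : ∀ {A B l r lB rB} p → (∀ x → x ∈ A → x ∉ B) →
    Represents A l r → Represents B lB rB →
    (∀ a b → a ∈ A → b ∈ B → Adj G a b ⇔ (l a ≤ p × p ≤ r a)) →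
    IsIntervalOn G (A ∪ B)
  insert-at-point {B = B} {rB = rB} p disjoint RA RB cross =
    represents⇒interval (Represents-glue disjoint
      (Represents-reparametrise (shiftFrom (suc p) d) (shiftFrom p d) (≤⇔shiftFrom-≤ p d) RA)
      (Represents-reparametrise (p +_) (p +_) (+-≤⇔ p) RB)
      λ a b a∈A b∈B →
        ⇔-sym (shiftFrom-meets-gap (≤-trans (left≤right RB b b∈B) (rB≤d b b∈B)) (rB≤d b b∈B))
          ⇔-∘ cross a b a∈A b∈B)
    where
    open Supremum (supremum rB (_∈? B)) renaming (value to d; upper to rB≤d)

  stabbing-point : ∀ {U A l r v} → Represents U l r → v ∈ U → A ⊆ U → v ∉ A →
    (∀ a b → a ∈ A → b ∈ A → a ≢ b → Adj G a v → Adj G b v → Adj G a b) →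
    ∃[ p ] (∀ a → a ∈ A → Adj G a v ⇔ (l a ≤ p × p ≤ r a))
  stabbing-point {A = A} {l} {r} {v} R v∈U A⊆U v∉A neighbours-adjacent =
    p , λ a a∈A → mk⇔ (stabbed ∘ inj₂ ∘ (a∈A ,_)) (meets-v a∈A)
    where
    Near : Pred (Fin n) _
    Near x = x ≡ v ⊎ (x ∈ A × Adj G x v)

    near? : Decidable Near
    near? x = (x ≟ v) ⊎-dec ((x ∈? A) ×-dec adj? x v)

    ≢v : ∀ {a} → a ∈ A → a ≢ v
    ≢v a∈A refl = v∉A a∈A

    adj⇔meet-v : ∀ {a} → a ∈ A → Adj G a v ⇔ Meet l r a v
    adj⇔meet-v {a} a∈A = adj⇔meet R a v (A⊆U a∈A) v∈U (≢v a∈A)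

    pairwise-meet : ∀ x y → Near x → Near y → l x ≤ r y
    pairwise-meet x y (inj₁ refl)        (inj₁ refl)        = left≤right R v v∈U
    pairwise-meet x y (inj₁ refl)        (inj₂ (y∈A , yv)) = proj₂ (to (adj⇔meet-v y∈A) yv)
    pairwise-meet x y (inj₂ (x∈A , xv)) (inj₁ refl)        = proj₁ (to (adj⇔meet-v x∈A) xv)
    pairwise-meet x y (inj₂ (x∈A , xv)) (inj₂ (y∈A , yv)) with x ≟ y
    ... | yes refl = left≤right R x (A⊆U x∈A)
    ... | no x≢y   = proj₁ (to (adj⇔meet R x y (A⊆U x∈A) (A⊆U y∈A) x≢y)
                               (neighbours-adjacent x y x∈A y∈A x≢y xv yv))

    point : ∃[ p ] (∀ x → Near x → l x ≤ p × p ≤ r x)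
    point = helly l r near? pairwise-meet

    p : ℕ
    p = proj₁ point

    stabbed : ∀ {x} → Near x → l x ≤ p × p ≤ r x
    stabbed = proj₂ point _

    meets-v : ∀ {a} → a ∈ A → l a ≤ p × p ≤ r a → Adj G a v
    meets-v a∈A (la≤p , p≤ra) =
      let (lv≤p , p≤rv) = stabbed (inj₁ refl)
      in from (adj⇔meet-v a∈A) (≤-trans la≤p p≤rv , ≤-trans lv≤p p≤ra)

  substitute-interval : FourHoleFree G → ∀ {U M UM l r v} → IsModuleIn G ⊤ M →
    Represents U l r → v ∈ U → v ∈ M → UM ⊆ M → IsIntervalOn G UM →
    IsIntervalOn G ((U ─ M) ∪ UM)
  substitute-interval hole-free {U} {M} {UM} {l} {r} {v}
                      M-module R v∈U v∈M UM⊆M (lM , rM , left≤rightM , adj⇔meetM) =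
    by-cliqueness (clique? UM)
    where
    ∉M : ∀ {a} → a ∈ U ─ M → a ∉ M
    ∉M = x∈p─q⇒x∉q U M

    R─ : Represents (U ─ M) l r
    R─ = Represents-⊆ (p─q⊆p U M) R

    disjoint : ∀ x → x ∈ U ─ M → x ∉ UM
    disjoint x x∈U─M = ∉M x∈U─M ∘ UM⊆M

    adj-via-v : ∀ {a b} → a ∈ U ─ M → b ∈ UM → Adj G a b ⇔ Adj G a v
    adj-via-v a∈U─M b∈UM = IsModuleIn-adj⇔ M-module ∈⊤ (∉M a∈U─M) (UM⊆M b∈UM) v∈M

    neighbours-adjacent : ¬ Clique UM → ∀ a b → a ∈ U ─ M → b ∈ U ─ M → a ≢ b →
      Adj G a v → Adj G b v → Adj G a b
    neighbours-adjacent ¬UM-clique a b a∈ b∈ a≢b av bv with adj? a b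
    ... | yes ab = ab
    ... | no ¬ab = contradiction
      (common-neighbours-clique hole-free a≢b ¬ab λ u u∈UM →
        from (adj-via-v a∈ u∈UM) av , from (adj-via-v b∈ u∈UM) bv)
      ¬UM-clique

    by-cliqueness : Dec (Clique UM) → IsIntervalOn G ((U ─ M) ∪ UM)
    by-cliqueness (yes UM-clique) =
      represents⇒interval (Represents-glue disjoint R─
        (Represents-clique UM-clique (left≤right R v v∈U))
        λ a b a∈ b∈ → adj⇔meet R a v (p─q⊆p U M a∈) v∈U (λ { refl → ∉M a∈ v∈M })
                        ⇔-∘ adj-via-v a∈ b∈)
    by-cliqueness (no ¬UM-clique) =
      let (p , stab) = stabbing-point R v∈U (p─q⊆p U M) (λ v∈ → ∉M v∈ v∈M)
                                      (neighbours-adjacent ¬UM-clique)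
      in insert-at-point p disjoint R─ record { left≤right = left≤rightM ; adj⇔meet = adj⇔meetM }
           λ a b a∈ b∈ → stab a a∈ ⇔-∘ adj-via-v a∈ b∈

substitution-size : (U M UM : Subset n) → UM ⊆ M → ∣ U ∩ M ∣ ≤ ∣ UM ∣ →
  ∣ U ∣ ≤ ∣ (U ─ M) ∪ UM ∣
substitution-size U M UM UM⊆M U∩M≤UM = begin
  ∣ U ∣                  ≡⟨ ∣p∣≡∣p─q∣+∣p∩q∣ U M ⟩
  ∣ U ─ M ∣ + ∣ U ∩ M ∣  ≤⟨ +-monoʳ-≤ ∣ U ─ M ∣ U∩M≤UM ⟩
  ∣ U ─ M ∣ + ∣ UM ∣     ≡⟨ ∣p∪q∣≡∣p∣+∣q∣ (U ─ M) UM disjoint ⟨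
  ∣ (U ─ M) ∪ UM ∣       ∎
  where
  open ≤-Reasoning
  disjoint : Empty ((U ─ M) ∩ UM)
  disjoint (x , x∈) = let (x∈U─M , x∈UM) = x∈p∩q⁻ (U ─ M) UM x∈
                      in x∈p─q⇒x∉q U M x∈U─M (UM⊆M x∈UM)

theorem1p5 : ∀ {n : ℕ} (G : Graph n) (U M : Subset n) →
    IsMaxIntervalIn G ⊤ U →
    IsModuleIn G ⊤ M →
    (∃ λ x → x ∈ M × x ∈ U) →
    IsModuleIn G U (M ∩ U) ×
    (FourHoleFree G → ∀ (UM : Subset n) → IsMaxIntervalIn G M UM →
    IsMaxIntervalIn G ⊤ ((U ─ M) ∪ UM))
theorem1p5 G U M (_ , (l , r , left≤right , adj⇔meet) , U-max) M-module (v , v∈M , v∈U) =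
  IsModuleIn-∩ G ⊆⊤ M-module ,
  λ hole-free UM (UM⊆M , UM-interval , UM-max) →
    ⊆⊤ ,
    substitute-interval G hole-free M-module R v∈U v∈M UM⊆M UM-interval ,
    λ U′ U′⊆⊤ U′-interval → ≤-trans (U-max U′ U′⊆⊤ U′-interval)
      (substitution-size U M UM UM⊆M
        (UM-max (U ∩ M) (p∩q⊆q U M) (represents⇒interval G (Represents-⊆ G (p∩q⊆p U M) R))))
  where
  R : Represents G U l r
  R = record { left≤right = left≤right ; adj⇔meet = adj⇔meet }
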